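{- Let $[\![\cdot]\!]$ be the translation from Linda into CPC defined below. Then for all Linda processes $P$: (i) if $P\to P'$ then $[\![P]\!]\to[\![P']\!]$; (ii) if $[\![P]\!]\to Q$ then $Q=[\![P']\!]$ for some $P'$ with $P\to P'$.
   Context: CPC (Concurrent Pattern Calculus): names from a countably infinite set; patterns $p::=\lambda x\mid x\mid\ulcorner x\urcorner\mid p\bullet p$ (binding, variable, protected name, compound; $\bullet$ left associative); communicable patterns contain no protected or binding names; unification $\{p\|q\}$: $\{x\|x\}=\{x\|\ulcorner x\urcorner\}=\{\ulcorner x\urcorner\|x\}=\{\ulcorner x\urcorner\|\ulcorner x\urcorner\}=(\{\},\{\})$; $\{\lambda x\|q\}=(\{q/x\},\{\})$ if $q$ communicable; $\{p\|\lambda x\}=(\{\},\{p/x\})$ if $p$ communicable; $\{p_1\bullet p_2\|q_1\bullet q_2\}=(\sigma_1\cup\sigma_2,\rho_1\cup\rho_2)$ if $\{p_i\|q_i\}=(\sigma_i,\rho_i)$; undefined otherwise. Processes $P::=0\mid\checkmark\mid P|P\mid !P\mid(\nu x)P\mid p\to P$ (binding names of $p$ bind in $P$); reduction: $(p\to P)|(q\to Q)\to\sigma P|\rho Q$ when $\{p\|q\}=(\sigma,\rho)$, closed under parallel, restriction and structural congruence $\equiv$ (least congruence with $\alpha$-conversion, $P|0\equiv P$, commutativity and associativity of $|$, $(\nu n)0\equiv0$, $(\nu n)(\nu m)P\equiv(\nu m)(\nu n)P$, $!P\equiv P|!P$, $P|(\nu n)Q\equiv(\nu n)(P|Q)$ for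 $n\notin{\sf fn}(P)$). Linda: processes $P::=0\mid\checkmark\mid\langle b_1,\ldots,b_k\rangle\mid(t_1,\ldots,t_k).P\mid(\nu n)P\mid P|P\mid !P$, with template fields $t::=\lambda x\mid\ulcorner b\urcorner$ (binding variables in a template pairwise distinct, binding in $P$). Matching: ${\sf Match}(\,;\,)=\{\}$, ${\sf Match}(\ulcorner b\urcorner;b)=\{\}$, ${\sf Match}(\lambda x;b)=\{b/x\}$, and ${\sf Match}(t,\tilde t;b,\tilde b)=\sigma_1\uplus\sigma_2$ if ${\sf Match}(t;b)=\sigma_1$, ${\sf Match}(\tilde t;\tilde b)=\sigma_2$. Reduction: $\langle\tilde b\rangle|(\tilde t).P\to\sigma P$ if ${\sf Match}(\tilde t;\tilde b)=\sigma$, closed under parallel, restriction and the same structural congruence. Translation: fix a name $\mathsf n$. Define ${\sf patt}(\,)=\lambda x\bullet\mathsf n$ and ${\sf patt}(t,\tilde t)=t\bullet\mathsf n\bullet{\sf patt}(\tilde t)$ (a template field $\lambda x$ read as the CPC binding name $\lambda x$, and $\ulcorner b\urcorner$ as the CPC protected name $\ulcorner b\urcorner$); ${\sf patb}(\,)=\mathsf n\bullet\lambda x$ and ${\sf patb}(b,\tilde b)=b\bullet\lambda x\bullet{\sf patb}(\tilde b)$, where each $x$ is a fresh name. Then $[\![(\tilde t).P]\!]={\sf patt}(\tilde t)\to[\![P]\!]$, $[\![\langle\tilde b\rangle]\!]={\sf patb}(\tilde b)\to0$, and $[\![\cdot]\!]$ is homomorphic on $0,\checkmark,|,!,\nu$.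 -}

module Defs where

-- Names are natural numbers used as de Bruijn indices; alpha-conversion is
-- therefore built into the syntax.  Binding convention ("nested"): a pattern
-- (or template) with k binding names binds k indices in its body; the
-- RIGHTMOST binding name is index 0, the leftmost is index k-1, and free
-- names of the context are shifted by k.  Names occurring inside a pattern
-- itself (variables, protected names) live in the outer scope.

open import Data.Nat using (ℕ; zero; suc; _+_; _≡ᵇ_)
open import Data.Bool using (Bool; true; false; _∧_; if_then_else_)
open import Data.List using (List; []; _∷_; _++_; reverse; length)
open import Data.Maybe using (Maybe; just; nothing)
open import Data.Product using (_×_; _,_)
open import Relation.Binary.PropositionalEquality using (_≡_)

infixl 6 _•_

data Pat : Set where
  bnd  : Pat
  var  : ℕ → Pat
  prot : ℕ → Pat
  _•_  : Pat → Pat → Pat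

bv : Pat → ℕ
bv bnd = 1
bv (var _) = 0
bv (prot _) = 0
bv (p • q) = bv p + bv q

communicable : Pat → Bool
communicable bnd = false
communicable (var _) = true
communicable (prot _) = false
communicable (p • q) = communicable p ∧ communicable q

infixr 4 _▹_
infixl 3 _∥_

data Proc : Set where
  nil  : Proc
  tick : Proc
  _∥_  : Proc → Proc → Proc
  rep  : Proc → Proc
  new  : Proc → Proc
  _▹_  : Pat → Proc → Proc

Sub : Set
Sub = ℕ → Pat

protect : Pat → Pat
protect bnd = bnd
protect (var x) = prot x
protect (prot x) = prot x
protect (p • q) = protect p • protect q

subPat : Sub → Pat → Pat
subPat σ bnd = bnd
subPat σ (var x) = σ x
subPat σ (prot x) = protect (σ x)
subPat σ (p • q) = subPat σ p • subPat σ q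

shift1 : Sub
shift1 i = var (suc i)

lift1 : Sub → Sub
lift1 σ zero = var zero
lift1 σ (suc i) = subPat shift1 (σ i)

liftSub : ℕ → Sub → Sub
liftSub zero σ = σ
liftSub (suc k) σ = lift1 (liftSub k σ)

subProc : Sub → Proc → Proc
subProc σ nil = nil
subProc σ tick = tick
subProc σ (P ∥ Q) = subProc σ P ∥ subProc σ Q
subProc σ (rep P) = rep (subProc σ P)
subProc σ (new P) = new (subProc (lift1 σ) P)
subProc σ (p ▹ P) = subPat σ p ▹ subProc (liftSub (bv p) σ) P

swap01 : Sub
swap01 zero = var (suc zero)
swap01 (suc zero) = var zero
swap01 (suc (suc i)) = var (suc (suc i))

envRev : List Pat → Sub
envRev [] i = var i
envRev (s ∷ ss) zero = s
envRev (s ∷ ss) (suc i) = envRev ss i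

-- the substitution given by the list of images of the binding names of a
-- pattern, listed left to right; it also removes the k bound indices
envOf : List Pat → Sub
envOf ss = envRev (reverse ss)

-- unification {p‖q} = (σ , ρ), images listed left to right
unify : Pat → Pat → Maybe (List Pat × List Pat)
unify bnd q = if communicable q then just (q ∷ [] , []) else nothing
unify p bnd = if communicable p then just ([] , p ∷ []) else nothing
unify (var x) (var y) = if x ≡ᵇ y then just ([] , []) else nothing
unify (var x) (prot y) = if x ≡ᵇ y then just ([] , []) else nothing
unify (prot x) (var y) = if x ≡ᵇ y then just ([] , []) else nothing
unify (prot x) (prot y) = if x ≡ᵇ y then just ([] , []) else nothing
unify (p₁ • p₂) (q₁ • q₂) with unify p₁ q₁ | unify p₂ q₂
... | just (σ₁ , ρ₁) | just (σ₂ , ρ₂) = just (σ₁ ++ σ₂ , ρ₁ ++ ρ₂)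
... | _ | _ = nothing
unify _ _ = nothing

infix 2 _≈_
data _≈_ : Proc → Proc → Set where
  ≈-refl  : ∀ {P} → P ≈ P
  ≈-sym   : ∀ {P Q} → P ≈ Q → Q ≈ P
  ≈-trans : ∀ {P Q R} → P ≈ Q → Q ≈ R → P ≈ R
  ≈-par   : ∀ {P P' Q Q'} → P ≈ P' → Q ≈ Q' → (P ∥ Q) ≈ (P' ∥ Q')
  ≈-rep   : ∀ {P P'} → P ≈ P' → rep P ≈ rep P'
  ≈-new   : ∀ {P P'} → P ≈ P' → new P ≈ new P'
  ≈-case  : ∀ {p P P'} → P ≈ P' → (p ▹ P) ≈ (p ▹ P')
  par-nil   : ∀ {P} → (P ∥ nil) ≈ P
  par-comm  : ∀ {P Q} → (P ∥ Q) ≈ (Q ∥ P)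
  par-assoc : ∀ {P Q R} → ((P ∥ Q) ∥ R) ≈ (P ∥ (Q ∥ R))
  new-nil   : new nil ≈ nil
  new-swap  : ∀ {P} → new (new P) ≈ new (new (subProc swap01 P))
  rep-unf   : ∀ {P} → rep P ≈ (P ∥ rep P)
  extrude   : ∀ {P Q} → (P ∥ new Q) ≈ new (subProc shift1 P ∥ Q)

infix 2 _⟶_
data _⟶_ : Proc → Proc → Set where
  comm   : ∀ {p q P Q σ ρ} → unify p q ≡ just (σ , ρ) →
           ((p ▹ P) ∥ (q ▹ Q)) ⟶ (subProc (envOf σ) P ∥ subProc (envOf ρ) Q)
  par    : ∀ {P P' Q} → P ⟶ P' → (P ∥ Q) ⟶ (P' ∥ Q)
  res    : ∀ {P P'} → P ⟶ P' → new P ⟶ new P'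
  struct : ∀ {P P₁ Q₁ Q} → P ≈ P₁ → P₁ ⟶ Q₁ → Q₁ ≈ Q → P ⟶ Q

data Field : Set where
  bindF : Field
  protF : ℕ → Field

infixl 3 _∥L_

data LProc : Set where
  lnil  : LProc
  ltick : LProc
  out   : List ℕ → LProc
  inp   : List Field → LProc → LProc
  lnew  : LProc → LProc
  _∥L_  : LProc → LProc → LProc
  lrep  : LProc → LProc

bvT : List Field → ℕ
bvT [] = 0
bvT (bindF ∷ ts) = suc (bvT ts)
bvT (protF _ ∷ ts) = bvT ts

LSub : Set
LSub = ℕ → ℕ

liftL1 : LSub → LSub
liftL1 σ zero = zero
liftL1 σ (suc i) = suc (σ i)

liftL : ℕ → LSub → LSub
liftL zero σ = σ
liftL (suc k) σ = liftL1 (liftL k σ)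

subField : LSub → Field → Field
subField σ bindF = bindF
subField σ (protF b) = protF (σ b)

mapL : {A : Set} → (A → A) → List A → List A
mapL f [] = []
mapL f (x ∷ xs) = f x ∷ mapL f xs

subL : LSub → LProc → LProc
subL σ lnil = lnil
subL σ ltick = ltick
subL σ (out bs) = out (mapL σ bs)
subL σ (inp ts P) = inp (mapL (subField σ) ts) (subL (liftL (bvT ts) σ) P)
subL σ (lnew P) = lnew (subL (liftL1 σ) P)
subL σ (P ∥L Q) = subL σ P ∥L subL σ Q
subL σ (lrep P) = lrep (subL σ P)

swapL : LSub
swapL zero = suc zero
swapL (suc zero) = zero
swapL (suc (suc i)) = suc (suc i)

envRevL : List ℕ → LSub
envRevL [] i = i
envRevL (s ∷ ss) zero = s
envRevL (s ∷ ss) (suc i) = envRevL ss i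

envL : List ℕ → LSub
envL ss = envRevL (reverse ss)

-- Match(t̃; b̃), images of the binding fields listed left to right
match : List Field → List ℕ → Maybe (List ℕ)
match [] [] = just []
match (bindF ∷ ts) (b ∷ bs) with match ts bs
... | just σ = just (b ∷ σ)
... | nothing = nothing
match (protF c ∷ ts) (b ∷ bs) = if c ≡ᵇ b then match ts bs else nothing
match _ _ = nothing

infix 2 _≈L_
data _≈L_ : LProc → LProc → Set where
  ≈-refl  : ∀ {P} → P ≈L P
  ≈-sym   : ∀ {P Q} → P ≈L Q → Q ≈L P
  ≈-trans : ∀ {P Q R} → P ≈L Q → Q ≈L R → P ≈L R
  ≈-par   : ∀ {P P' Q Q'} → P ≈L P' → Q ≈L Q' → (P ∥L Q) ≈L (P' ∥L Q')
  ≈-rep   : ∀ {P P'} → P ≈L P' → lrep P ≈L lrep P'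
  ≈-new   : ∀ {P P'} → P ≈L P' → lnew P ≈L lnew P'
  ≈-inp   : ∀ {ts P P'} → P ≈L P' → inp ts P ≈L inp ts P'
  par-nil   : ∀ {P} → (P ∥L lnil) ≈L P
  par-comm  : ∀ {P Q} → (P ∥L Q) ≈L (Q ∥L P)
  par-assoc : ∀ {P Q R} → ((P ∥L Q) ∥L R) ≈L (P ∥L (Q ∥L R))
  new-nil   : lnew lnil ≈L lnil
  new-swap  : ∀ {P} → lnew (lnew P) ≈L lnew (lnew (subL swapL P))
  rep-unf   : ∀ {P} → lrep P ≈L (P ∥L lrep P)
  extrude   : ∀ {P Q} → (P ∥L lnew Q) ≈L lnew (subL suc P ∥L Q)

infix 2 _⟶L_
data _⟶L_ : LProc → LProc → Set where
  comm   : ∀ {bs ts P σ} → match ts bs ≡ just σ →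
           (out bs ∥L inp ts P) ⟶L subL (envL σ) P
  par    : ∀ {P P' Q} → P ⟶L P' → (P ∥L Q) ⟶L (P' ∥L Q)
  res    : ∀ {P P'} → P ⟶L P' → lnew P ⟶L lnew P'
  struct : ∀ {P P₁ Q₁ Q} → P ≈L P₁ → P₁ ⟶L Q₁ → Q₁ ≈L Q → P ⟶L Q

-- Translation; the first argument is the (current de Bruijn index of the)
-- fixed name 𝗇.

fieldPat : Field → Pat
fieldPat bindF = bnd
fieldPat (protF b) = prot b

patt : ℕ → List Field → Pat
patt n [] = bnd • var n
patt n (t ∷ ts) = fieldPat t • var n • patt n ts

patb : ℕ → List ℕ → Pat
patb n [] = var n • bnd
patb n (b ∷ bs) = var b • bnd • patb n bs

-- In ⟦(t̃).P⟧ the fresh final binder of patt is the rightmost one (index 0),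
-- not occurring in ⟦P⟧, hence the shift.
⟦_⟧ : LProc → ℕ → Proc
⟦ lnil ⟧ n = nil
⟦ ltick ⟧ n = tick
⟦ out bs ⟧ n = patb n bs ▹ nil
⟦ inp ts P ⟧ n = patt n ts ▹ subProc shift1 (⟦ P ⟧ (bvT ts + n))
⟦ lnew P ⟧ n = new (⟦ P ⟧ (suc n))
⟦ P ∥L Q ⟧ n = ⟦ P ⟧ n ∥ ⟦ Q ⟧ n
⟦ lrep P ⟧ n = rep (⟦ P ⟧ n)

-- A Linda communication ⟨b̃⟩ | (t̃).P becomes an
-- interaction of the prefixes patb(b̃) and patt(t̃), whose unification succeeds
-- exactly when Match(t̃; b̃) does (unify-out-inp); the resulting substitution
-- acts on the translated body as Match does on P (tr-receive).  Congruent Linda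
-- processes have congruent translations (tr-≈), because translation commutes
-- with renaming (ren-tr) and renaming preserves congruence in both calculi.
--
-- A CPC reduction may pass, via structural
-- congruence, through processes that are not translations, so we use an
-- invariant: `decodable n X` recognises translations with marker n up to
-- congruence inside prefix bodies and `decode n X` reads back the Linda
-- process.  Both are invariant under ≈, translations decode to themselves, and
-- a decodable X is congruent to ⟦ decode n X ⟧ n; induction on the CPC
-- reduction of a decodable process then yields the matching Linda step.

module Submission where

open import Defs
open import Data.Nat using (ℕ; zero; suc; _+_; _≡ᵇ_)
open import Data.Nat.Properties using (suc-injective; ≡ᵇ⇒≡; ≡⇒≡ᵇ)
open import Data.Bool using (Bool; true; false; _∧_; if_then_else_; not; T)
open import Data.Bool.Properties using (∧-comm; ∧-assoc; ∧-identityʳ; ∧-zeroʳ; ∧-idem; T-∧; T-≡)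
open import Data.Unit using (⊤; tt)
open import Data.List using (List; []; _∷_; _++_; reverse; length; map; replicate)
open import Data.List.Properties using (reverse-++; reverse-map; length-reverse)
open import Data.Maybe using (Maybe; just; nothing) renaming (map to mapMaybe)
open import Data.Maybe.Properties using (map-∘)
open import Data.Product using (Σ; _×_; _,_; proj₁; proj₂; swap)
open import Data.Empty using (⊥-elim)
open import Function using (_∘_; id)
open import Function.Bundles using (Equivalence)
open import Function.Definitions using (Injective)
open import Relation.Binary.PropositionalEquality

Ren : Set
Ren = ℕ → ℕ

renPat : Ren → Pat → Pat
renPat f bnd = bnd
renPat f (var x) = var (f x)
renPat f (prot x) = prot (f x)
renPat f (p • q) = renPat f p • renPat f q

renProc : Ren → Proc → Proc
renProc f nil = nil
renProc f tick = tick
renProc f (P ∥ Q) = renProc f P ∥ renProc f Q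
renProc f (rep P) = rep (renProc f P)
renProc f (new P) = new (renProc (liftL1 f) P)
renProc f (p ▹ P) = renPat f p ▹ renProc (liftL (bv p) f) P

bv-ren : ∀ f p → bv (renPat f p) ≡ bv p
bv-ren f bnd = refl
bv-ren f (var x) = refl
bv-ren f (prot x) = refl
bv-ren f (p • q) = cong₂ _+_ (bv-ren f p) (bv-ren f q)

liftL-cong : ∀ {f g} k → f ≗ g → liftL k f ≗ liftL k g
liftL-cong zero e = e
liftL-cong (suc k) e zero = refl
liftL-cong (suc k) e (suc i) = cong suc (liftL-cong k e i)

liftL-∘ : ∀ k f g → liftL k f ∘ liftL k g ≗ liftL k (f ∘ g)
liftL-∘ zero f g i = refl
liftL-∘ (suc k) f g zero = refl
liftL-∘ (suc k) f g (suc i) = cong suc (liftL-∘ k f g i)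

liftL-id : ∀ k → liftL k id ≗ id
liftL-id zero i = refl
liftL-id (suc k) zero = refl
liftL-id (suc k) (suc i) = cong suc (liftL-id k i)

liftL-+ : ∀ m f k → liftL m f (m + k) ≡ m + f k
liftL-+ zero f k = refl
liftL-+ (suc m) f k = cong suc (liftL-+ m f k)

swapL-natural : ∀ f → swapL ∘ liftL 2 f ≗ liftL 2 f ∘ swapL
swapL-natural f zero = refl
swapL-natural f (suc zero) = refl
swapL-natural f (suc (suc i)) = refl

renPat-cong : ∀ {f g} → f ≗ g → ∀ p → renPat f p ≡ renPat g p
renPat-cong e bnd = refl
renPat-cong e (var x) = cong var (e x)
renPat-cong e (prot x) = cong prot (e x)
renPat-cong e (p • q) = cong₂ _•_ (renPat-cong e p) (renPat-cong e q)

renProc-cong : ∀ {f g} → f ≗ g → ∀ P → renProc f P ≡ renProc g P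
renProc-cong e nil = refl
renProc-cong e tick = refl
renProc-cong e (P ∥ Q) = cong₂ _∥_ (renProc-cong e P) (renProc-cong e Q)
renProc-cong e (rep P) = cong rep (renProc-cong e P)
renProc-cong e (new P) = cong new (renProc-cong (liftL-cong 1 e) P)
renProc-cong e (p ▹ P) =
  cong₂ _▹_ (renPat-cong e p) (renProc-cong (liftL-cong (bv p) e) P)

renPat-∘ : ∀ f g p → renPat f (renPat g p) ≡ renPat (f ∘ g) p
renPat-∘ f g bnd = refl
renPat-∘ f g (var x) = refl
renPat-∘ f g (prot x) = refl
renPat-∘ f g (p • q) = cong₂ _•_ (renPat-∘ f g p) (renPat-∘ f g q)

renProc-∘ : ∀ f g P → renProc f (renProc g P) ≡ renProc (f ∘ g) P
renProc-∘ f g nil = refl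
renProc-∘ f g tick = refl
renProc-∘ f g (P ∥ Q) = cong₂ _∥_ (renProc-∘ f g P) (renProc-∘ f g Q)
renProc-∘ f g (rep P) = cong rep (renProc-∘ f g P)
renProc-∘ f g (new P) =
  cong new (trans (renProc-∘ (liftL1 f) (liftL1 g) P) (renProc-cong (liftL-∘ 1 f g) P))
renProc-∘ f g (p ▹ P) rewrite bv-ren g p =
  cong₂ _▹_ (renPat-∘ f g p)
    (trans (renProc-∘ (liftL (bv p) f) (liftL (bv p) g) P) (renProc-cong (liftL-∘ (bv p) f g) P))

renPat-id : ∀ p → renPat id p ≡ p
renPat-id bnd = refl
renPat-id (var x) = refl
renPat-id (prot x) = refl
renPat-id (p • q) = cong₂ _•_ (renPat-id p) (renPat-id q)

renProc-id : ∀ P → renProc id P ≡ P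
renProc-id nil = refl
renProc-id tick = refl
renProc-id (P ∥ Q) = cong₂ _∥_ (renProc-id P) (renProc-id Q)
renProc-id (rep P) = cong rep (renProc-id P)
renProc-id (new P) = cong new (trans (renProc-cong (liftL-id 1) P) (renProc-id P))
renProc-id (p ▹ P) =
  cong₂ _▹_ (renPat-id p) (trans (renProc-cong (liftL-id (bv p)) P) (renProc-id P))

renProc-square : ∀ {f g f' g'} → f ∘ g ≗ g' ∘ f' → ∀ P →
  renProc f (renProc g P) ≡ renProc g' (renProc f' P)
renProc-square {f} {g} {f'} {g'} e P = begin
  renProc f (renProc g P)   ≡⟨ renProc-∘ f g P ⟩
  renProc (f ∘ g) P         ≡⟨ renProc-cong e P ⟩
  renProc (g' ∘ f') P       ≡⟨ sym (renProc-∘ g' f' P) ⟩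
  renProc g' (renProc f' P) ∎
  where open ≡-Reasoning

lift1-ren : ∀ {σ f} → σ ≗ var ∘ f → lift1 σ ≗ var ∘ liftL1 f
lift1-ren e zero = refl
lift1-ren e (suc i) rewrite e i = refl

liftSub-ren : ∀ {σ f} → σ ≗ var ∘ f → ∀ k → liftSub k σ ≗ var ∘ liftL k f
liftSub-ren e zero = e
liftSub-ren e (suc k) = lift1-ren (liftSub-ren e k)

subPat-ren : ∀ {σ f} → σ ≗ var ∘ f → ∀ p → subPat σ p ≡ renPat f p
subPat-ren e bnd = refl
subPat-ren e (var x) = e x
subPat-ren e (prot x) rewrite e x = refl
subPat-ren e (p • q) = cong₂ _•_ (subPat-ren e p) (subPat-ren e q)

subProc-ren : ∀ {σ f} → σ ≗ var ∘ f → ∀ P → subProc σ P ≡ renProc f P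
subProc-ren e nil = refl
subProc-ren e tick = refl
subProc-ren e (P ∥ Q) = cong₂ _∥_ (subProc-ren e P) (subProc-ren e Q)
subProc-ren e (rep P) = cong rep (subProc-ren e P)
subProc-ren e (new P) = cong new (subProc-ren (lift1-ren e) P)
subProc-ren e (p ▹ P) =
  cong₂ _▹_ (subPat-ren e p) (subProc-ren (liftSub-ren e (bv p)) P)

shift-ren : ∀ P → subProc shift1 P ≡ renProc suc P
shift-ren = subProc-ren (λ i → refl)

swap-ren : ∀ P → subProc swap01 P ≡ renProc swapL P
swap-ren = subProc-ren swap01-ren
  where
  swap01-ren : swap01 ≗ var ∘ swapL
  swap01-ren zero = refl
  swap01-ren (suc zero) = refl
  swap01-ren (suc (suc i)) = refl

≡⇒≈ : ∀ {P Q} → P ≡ Q → P ≈ Q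
≡⇒≈ refl = ≈-refl

ren-≈ : ∀ f {P Q} → P ≈ Q → renProc f P ≈ renProc f Q
ren-≈ f ≈-refl = ≈-refl
ren-≈ f (≈-sym e) = ≈-sym (ren-≈ f e)
ren-≈ f (≈-trans e e') = ≈-trans (ren-≈ f e) (ren-≈ f e')
ren-≈ f (≈-par e e') = ≈-par (ren-≈ f e) (ren-≈ f e')
ren-≈ f (≈-rep e) = ≈-rep (ren-≈ f e)
ren-≈ f (≈-new e) = ≈-new (ren-≈ (liftL1 f) e)
ren-≈ f (≈-case {p} e) = ≈-case (ren-≈ (liftL (bv p) f) e)
ren-≈ f par-nil = par-nil
ren-≈ f par-comm = par-comm
ren-≈ f par-assoc = par-assoc
ren-≈ f new-nil = new-nil
ren-≈ f (new-swap {P}) = ≈-trans new-swap (≈-new (≈-new (≡⇒≈ swapped)))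
  where
  swapped : subProc swap01 (renProc (liftL 2 f) P) ≡ renProc (liftL 2 f) (subProc swap01 P)
  swapped rewrite swap-ren (renProc (liftL 2 f) P) | swap-ren P =
    renProc-square (swapL-natural f) P
ren-≈ f rep-unf = rep-unf
ren-≈ f (extrude {P}) = ≈-trans extrude (≈-new (≈-par (≡⇒≈ shifted) ≈-refl))
  where
  shifted : subProc shift1 (renProc f P) ≡ renProc (liftL1 f) (subProc shift1 P)
  shifted rewrite shift-ren (renProc f P) | shift-ren P = renProc-square (λ i → refl) P

mapL-cong : ∀ {A : Set} {f g : A → A} → f ≗ g → ∀ xs → mapL f xs ≡ mapL g xs
mapL-cong e [] = refl
mapL-cong e (x ∷ xs) = cong₂ _∷_ (e x) (mapL-cong e xs)

mapL-∘ : ∀ {A : Set} (f g : A → A) xs → mapL f (mapL g xs) ≡ mapL (f ∘ g) xs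
mapL-∘ f g [] = refl
mapL-∘ f g (x ∷ xs) = cong (f (g x) ∷_) (mapL-∘ f g xs)

mapL-id : ∀ {A : Set} (xs : List A) → mapL id xs ≡ xs
mapL-id [] = refl
mapL-id (x ∷ xs) = cong (x ∷_) (mapL-id xs)

bvT-sub : ∀ f ts → bvT (mapL (subField f) ts) ≡ bvT ts
bvT-sub f [] = refl
bvT-sub f (bindF ∷ ts) = cong suc (bvT-sub f ts)
bvT-sub f (protF x ∷ ts) = bvT-sub f ts

subField-cong : ∀ {f g} → f ≗ g → subField f ≗ subField g
subField-cong e bindF = refl
subField-cong e (protF x) = cong protF (e x)

subField-∘ : ∀ f g → subField f ∘ subField g ≗ subField (f ∘ g)
subField-∘ f g bindF = refl
subField-∘ f g (protF x) = refl

subField-id : subField id ≗ id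
subField-id bindF = refl
subField-id (protF x) = refl

subL-cong : ∀ {f g} → f ≗ g → ∀ P → subL f P ≡ subL g P
subL-cong e lnil = refl
subL-cong e ltick = refl
subL-cong e (out bs) = cong out (mapL-cong e bs)
subL-cong e (inp ts P) =
  cong₂ inp (mapL-cong (subField-cong e) ts) (subL-cong (liftL-cong (bvT ts) e) P)
subL-cong e (lnew P) = cong lnew (subL-cong (liftL-cong 1 e) P)
subL-cong e (P ∥L Q) = cong₂ _∥L_ (subL-cong e P) (subL-cong e Q)
subL-cong e (lrep P) = cong lrep (subL-cong e P)

subL-∘ : ∀ f g P → subL f (subL g P) ≡ subL (f ∘ g) P
subL-∘ f g lnil = refl
subL-∘ f g ltick = refl
subL-∘ f g (out bs) = cong out (mapL-∘ f g bs)
subL-∘ f g (inp ts P) rewrite bvT-sub g ts =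
  cong₂ inp (trans (mapL-∘ (subField f) (subField g) ts) (mapL-cong (subField-∘ f g) ts))
            (trans (subL-∘ (liftL (bvT ts) f) (liftL (bvT ts) g) P) (subL-cong (liftL-∘ (bvT ts) f g) P))
subL-∘ f g (lnew P) =
  cong lnew (trans (subL-∘ (liftL1 f) (liftL1 g) P) (subL-cong (liftL-∘ 1 f g) P))
subL-∘ f g (P ∥L Q) = cong₂ _∥L_ (subL-∘ f g P) (subL-∘ f g Q)
subL-∘ f g (lrep P) = cong lrep (subL-∘ f g P)

subL-id : ∀ P → subL id P ≡ P
subL-id lnil = refl
subL-id ltick = refl
subL-id (out bs) = cong out (mapL-id bs)
subL-id (inp ts P) =
  cong₂ inp (trans (mapL-cong subField-id ts) (mapL-id ts))
            (trans (subL-cong (liftL-id (bvT ts)) P) (subL-id P))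
subL-id (lnew P) = cong lnew (trans (subL-cong (liftL-id 1) P) (subL-id P))
subL-id (P ∥L Q) = cong₂ _∥L_ (subL-id P) (subL-id Q)
subL-id (lrep P) = cong lrep (subL-id P)

subL-square : ∀ {f g f' g'} → f ∘ g ≗ g' ∘ f' → ∀ P →
  subL f (subL g P) ≡ subL g' (subL f' P)
subL-square {f} {g} {f'} {g'} e P = begin
  subL f (subL g P)   ≡⟨ subL-∘ f g P ⟩
  subL (f ∘ g) P      ≡⟨ subL-cong e P ⟩
  subL (g' ∘ f') P    ≡⟨ sym (subL-∘ g' f' P) ⟩
  subL g' (subL f' P) ∎
  where open ≡-Reasoning

≡⇒≈L : ∀ {P Q} → P ≡ Q → P ≈L Q
≡⇒≈L refl = ≈-refl

subL-≈L : ∀ f {P Q} → P ≈L Q → subL f P ≈L subL f Q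
subL-≈L f ≈-refl = ≈-refl
subL-≈L f (≈-sym e) = ≈-sym (subL-≈L f e)
subL-≈L f (≈-trans e e') = ≈-trans (subL-≈L f e) (subL-≈L f e')
subL-≈L f (≈-par e e') = ≈-par (subL-≈L f e) (subL-≈L f e')
subL-≈L f (≈-rep e) = ≈-rep (subL-≈L f e)
subL-≈L f (≈-new e) = ≈-new (subL-≈L (liftL1 f) e)
subL-≈L f (≈-inp {ts} e) = ≈-inp (subL-≈L (liftL (bvT ts) f) e)
subL-≈L f par-nil = par-nil
subL-≈L f par-comm = par-comm
subL-≈L f par-assoc = par-assoc
subL-≈L f new-nil = new-nil
subL-≈L f (new-swap {P}) =
  ≈-trans new-swap (≈-new (≈-new (≡⇒≈L (subL-square (swapL-natural f) P))))
subL-≈L f rep-unf = rep-unf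
subL-≈L f (extrude {P}) =
  ≈-trans extrude (≈-new (≈-par (≡⇒≈L (subL-square (λ i → refl) P)) ≈-refl))

bv-patt : ∀ n ts → bv (patt n ts) ≡ suc (bvT ts)
bv-patt n [] = refl
bv-patt n (bindF ∷ ts) = cong suc (bv-patt n ts)
bv-patt n (protF x ∷ ts) = bv-patt n ts

ren-patt : ∀ f n ts → renPat f (patt n ts) ≡ patt (f n) (mapL (subField f) ts)
ren-patt f n [] = refl
ren-patt f n (bindF ∷ ts) = cong (bnd • var (f n) •_) (ren-patt f n ts)
ren-patt f n (protF x ∷ ts) = cong (prot (f x) • var (f n) •_) (ren-patt f n ts)

ren-patb : ∀ f n bs → renPat f (patb n bs) ≡ patb (f n) (mapL f bs)
ren-patb f n [] = refl
ren-patb f n (b ∷ bs) = cong (var (f b) • bnd •_) (ren-patb f n bs)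

ren-tr : ∀ f L k → renProc f (⟦ L ⟧ k) ≡ ⟦ subL f L ⟧ (f k)
ren-tr f lnil k = refl
ren-tr f ltick k = refl
ren-tr f (out bs) k = cong (_▹ nil) (ren-patb f k bs)
ren-tr f (inp ts P) k rewrite bv-patt k ts | bvT-sub f ts =
  cong₂ _▹_ (ren-patt f k ts) body
  where
  b = bvT ts
  g = liftL b f
  body : renProc (liftL1 g) (subProc shift1 (⟦ P ⟧ (b + k)))
       ≡ subProc shift1 (⟦ subL g P ⟧ (b + f k))
  body = begin
    renProc (liftL1 g) (subProc shift1 (⟦ P ⟧ (b + k)))
      ≡⟨ cong (renProc (liftL1 g)) (shift-ren _) ⟩
    renProc (liftL1 g) (renProc suc (⟦ P ⟧ (b + k)))
      ≡⟨ renProc-square (λ i → refl) _ ⟩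
    renProc suc (renProc g (⟦ P ⟧ (b + k)))
      ≡⟨ cong (renProc suc) (ren-tr g P (b + k)) ⟩
    renProc suc (⟦ subL g P ⟧ (g (b + k)))
      ≡⟨ cong (renProc suc ∘ ⟦ subL g P ⟧) (liftL-+ b f k) ⟩
    renProc suc (⟦ subL g P ⟧ (b + f k))
      ≡⟨ sym (shift-ren _) ⟩
    subProc shift1 (⟦ subL g P ⟧ (b + f k)) ∎
    where open ≡-Reasoning
ren-tr f (lnew P) k = cong new (ren-tr (liftL1 f) P (suc k))
ren-tr f (P ∥L Q) k = cong₂ _∥_ (ren-tr f P k) (ren-tr f Q k)
ren-tr f (lrep P) k = cong rep (ren-tr f P k)

tr-≈ : ∀ {P Q} → P ≈L Q → ∀ n → ⟦ P ⟧ n ≈ ⟦ Q ⟧ n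
tr-≈ ≈-refl n = ≈-refl
tr-≈ (≈-sym e) n = ≈-sym (tr-≈ e n)
tr-≈ (≈-trans e e') n = ≈-trans (tr-≈ e n) (tr-≈ e' n)
tr-≈ (≈-par e e') n = ≈-par (tr-≈ e n) (tr-≈ e' n)
tr-≈ (≈-rep e) n = ≈-rep (tr-≈ e n)
tr-≈ (≈-new e) n = ≈-new (tr-≈ e (suc n))
tr-≈ (≈-inp {ts} {P} {P'} e) n rewrite shift-ren (⟦ P ⟧ (bvT ts + n)) | shift-ren (⟦ P' ⟧ (bvT ts + n)) =
  ≈-case (ren-≈ suc (tr-≈ e (bvT ts + n)))
tr-≈ par-nil n = par-nil
tr-≈ par-comm n = par-comm
tr-≈ par-assoc n = par-assoc
tr-≈ new-nil n = new-nil
tr-≈ (new-swap {P}) n =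
  ≈-trans new-swap (≈-new (≈-new (≡⇒≈ (trans (swap-ren _) (ren-tr swapL P (suc (suc n)))))))
tr-≈ rep-unf n = rep-unf
tr-≈ (extrude {P}) n =
  ≈-trans extrude (≈-new (≈-par (≡⇒≈ (trans (shift-ren _) (ren-tr suc P n))) ≈-refl))

≡ᵇ-cong : ∀ {a b c d} → (a ≡ b → c ≡ d) → (c ≡ d → a ≡ b) → (a ≡ᵇ b) ≡ (c ≡ᵇ d)
≡ᵇ-cong {a} {b} {c} {d} to from with a ≡ᵇ b in e | c ≡ᵇ d in e'
... | true | true = refl
... | false | false = refl
... | true | false = ⊥-elim (subst T e' (≡⇒≡ᵇ c d (to (≡ᵇ⇒≡ a b (Equivalence.from T-≡ e)))))
... | false | true = ⊥-elim (subst T e (≡⇒≡ᵇ a b (from (≡ᵇ⇒≡ c d (Equivalence.from T-≡ e')))))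

≡ᵇ-refl : ∀ a → (a ≡ᵇ a) ≡ true
≡ᵇ-refl a = Equivalence.to T-≡ (≡⇒≡ᵇ a a refl)

combine : Maybe (List Pat × List Pat) → Maybe (List Pat × List Pat) → Maybe (List Pat × List Pat)
combine (just (σ₁ , ρ₁)) (just (σ₂ , ρ₂)) = just (σ₁ ++ σ₂ , ρ₁ ++ ρ₂)
combine _ _ = nothing

unify-• : ∀ p₁ p₂ q₁ q₂ → unify (p₁ • p₂) (q₁ • q₂) ≡ combine (unify p₁ q₁) (unify p₂ q₂)
unify-• p₁ p₂ q₁ q₂ with unify p₁ q₁ | unify p₂ q₂
... | just _ | just _ = refl
... | just _ | nothing = refl
... | nothing | _ = refl

combine-nothing : ∀ x → combine x nothing ≡ nothing
combine-nothing (just _) = refl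
combine-nothing nothing = refl

combine-swap : ∀ x y → combine (mapMaybe swap x) (mapMaybe swap y) ≡ mapMaybe swap (combine x y)
combine-swap (just _) (just _) = refl
combine-swap (just _) nothing = refl
combine-swap nothing y = refl

unify-sym : ∀ p q → unify q p ≡ mapMaybe swap (unify p q)
unify-sym bnd bnd = refl
unify-sym bnd (var y) = refl
unify-sym bnd (prot y) = refl
unify-sym bnd (q₁ • q₂) with communicable q₁ ∧ communicable q₂
... | true = refl
... | false = refl
unify-sym (var x) bnd = refl
unify-sym (prot x) bnd = refl
unify-sym (p₁ • p₂) bnd with communicable p₁ ∧ communicable p₂
... | true = refl
... | false = refl
unify-sym (var x) (var y) = sameName-sym x y
  where
  sameName-sym : ∀ x y → (if y ≡ᵇ x then just ([] , []) else nothing)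
                       ≡ mapMaybe swap (if x ≡ᵇ y then just ([] , []) else nothing)
  sameName-sym x y rewrite ≡ᵇ-cong {y} {x} sym sym with x ≡ᵇ y
  ... | true = refl
  ... | false = refl
unify-sym (var x) (prot y) = unify-sym (var x) (var y)
unify-sym (prot x) (var y) = unify-sym (var x) (var y)
unify-sym (prot x) (prot y) = unify-sym (var x) (var y)
unify-sym (var x) (q₁ • q₂) = refl
unify-sym (prot x) (q₁ • q₂) = refl
unify-sym (p₁ • p₂) (var y) = refl
unify-sym (p₁ • p₂) (prot y) = refl
unify-sym (p₁ • p₂) (q₁ • q₂)
  rewrite unify-• p₁ p₂ q₁ q₂ | unify-• q₁ q₂ p₁ p₂ | unify-sym p₁ q₁ | unify-sym p₂ q₂ =
  combine-swap (unify p₁ q₁) (unify p₂ q₂)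

inputImages : ℕ → List ℕ → List Pat
inputImages n σ = map var σ ++ var n ∷ []

outputImages : ℕ → List ℕ → List Pat
outputImages n bs = replicate (suc (length bs)) (var n)

unify-inp-out : ∀ n ts bs → unify (patt n ts) (patb n bs)
  ≡ mapMaybe (λ σ → inputImages n σ , outputImages n bs) (match ts bs)
unify-inp-out n [] [] = refl
unify-inp-out n [] (b ∷ bs) = refl
unify-inp-out n (bindF ∷ ts) [] = refl
unify-inp-out n (protF c ∷ ts) [] = refl
unify-inp-out n (bindF ∷ ts) (b ∷ bs)
  rewrite unify-• (bnd • var n) (patt n ts) (var b • bnd) (patb n bs) | unify-inp-out n ts bs
  with match ts bs
... | just _ = refl
... | nothing = refl
unify-inp-out n (protF c ∷ ts) (b ∷ bs)
  rewrite unify-• (prot c • var n) (patt n ts) (var b • bnd) (patb n bs) | unify-inp-out n ts bs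
  with c ≡ᵇ b
... | false = refl
... | true with match ts bs
... | just _ = refl
... | nothing = refl

unify-out-inp : ∀ n ts bs → unify (patb n bs) (patt n ts)
  ≡ mapMaybe (λ σ → outputImages n bs , inputImages n σ) (match ts bs)
unify-out-inp n ts bs rewrite unify-sym (patt n ts) (patb n bs) | unify-inp-out n ts bs =
  sym (map-∘ (match ts bs))

-- Two translated inputs never interact: template fields are not communicable.
field-incommunicable : ∀ t → communicable (fieldPat t) ≡ false
field-incommunicable bindF = refl
field-incommunicable (protF x) = refl

unify-inp-inp : ∀ n ts ts' → unify (patt n ts) (patt n ts') ≡ nothing
unify-inp-inp n [] [] = refl
unify-inp-inp n [] (t ∷ ts')
  rewrite unify-• bnd (var n) (fieldPat t • var n) (patt n ts') | field-incommunicable t = refl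
unify-inp-inp n (t ∷ ts) []
  rewrite unify-• (fieldPat t • var n) (patt n ts) bnd (var n) | field-incommunicable t = refl
unify-inp-inp n (t ∷ ts) (t' ∷ ts')
  rewrite unify-• (fieldPat t • var n) (patt n ts) (fieldPat t' • var n) (patt n ts')
        | unify-inp-inp n ts ts' = combine-nothing _

-- Two translated outputs never interact: their binding names face each other.
unify-out-out : ∀ n bs bs' → unify (patb n bs) (patb n bs') ≡ nothing
unify-out-out n [] [] rewrite unify-• (var n) bnd (var n) bnd = combine-nothing _
unify-out-out n [] (b ∷ bs') = refl
unify-out-out n (b ∷ bs) [] = refl
unify-out-out n (b ∷ bs) (b' ∷ bs')
  rewrite unify-• (var b • bnd) (patb n bs) (var b' • bnd) (patb n bs')
        | unify-• (var b) bnd (var b') bnd | combine-nothing (unify (var b) (var b')) = refl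

match-length : ∀ ts bs {σ} → match ts bs ≡ just σ → length σ ≡ bvT ts
match-length [] [] refl = refl
match-length (bindF ∷ ts) (b ∷ bs) e with match ts bs in e'
match-length (bindF ∷ ts) (b ∷ bs) refl | just σ = cong suc (match-length ts bs e')
match-length (protF c ∷ ts) (b ∷ bs) e with c ≡ᵇ b
... | true = match-length ts bs e
match-length (protF c ∷ ts) (b ∷ bs) () | false
match-length [] (b ∷ bs) ()
match-length (bindF ∷ ts) [] ()
match-length (protF c ∷ ts) [] ()

envL-beyond : ∀ σ n → envL σ (length σ + n) ≡ n
envL-beyond σ n rewrite sym (length-reverse σ) = go (reverse σ)
  where
  go : ∀ xs → envRevL xs (length xs + n) ≡ n
  go [] = refl
  go (x ∷ xs) = go xs

-- The renaming performed on the body of a translated input receiving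
-- inputImages: the trailing binder (index 0) goes to the marker.
inputRen : ℕ → List ℕ → Ren
inputRen n σ zero = n
inputRen n σ (suc i) = envL σ i

envOf-inputImages : ∀ n σ → envOf (inputImages n σ) ≗ var ∘ inputRen n σ
envOf-inputImages n σ i rewrite reverse-++ (map var σ) (var n ∷ []) with i
... | zero = refl
... | suc j rewrite sym (reverse-map var σ) = envRev-map (reverse σ) j
  where
  envRev-map : ∀ ys j → envRev (map var ys) j ≡ var (envRevL ys j)
  envRev-map [] j = refl
  envRev-map (y ∷ ys) zero = refl
  envRev-map (y ∷ ys) (suc j) = envRev-map ys j

tr-receive : ∀ n σ R → subProc (envOf (inputImages n σ)) (subProc shift1 (⟦ R ⟧ (length σ + n)))
                       ≡ ⟦ subL (envL σ) R ⟧ n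
tr-receive n σ R = begin
  subProc (envOf (inputImages n σ)) (subProc shift1 (⟦ R ⟧ (length σ + n)))
    ≡⟨ cong (subProc _) (shift-ren _) ⟩
  subProc (envOf (inputImages n σ)) (renProc suc (⟦ R ⟧ (length σ + n)))
    ≡⟨ subProc-ren (envOf-inputImages n σ) _ ⟩
  renProc (inputRen n σ) (renProc suc (⟦ R ⟧ (length σ + n)))
    ≡⟨ renProc-∘ (inputRen n σ) suc _ ⟩
  renProc (envL σ) (⟦ R ⟧ (length σ + n))
    ≡⟨ ren-tr (envL σ) R _ ⟩
  ⟦ subL (envL σ) R ⟧ (envL σ (length σ + n))
    ≡⟨ cong ⟦ subL (envL σ) R ⟧ (envL-beyond σ n) ⟩
  ⟦ subL (envL σ) R ⟧ n ∎
  where open ≡-Reasoning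

simulate : ∀ {P P'} → P ⟶L P' → ∀ n → ⟦ P ⟧ n ⟶ ⟦ P' ⟧ n
simulate (comm {bs} {ts} {P} {σ} m) n =
  struct ≈-refl (comm interact) (≈-trans par-comm (≈-trans par-nil (≡⇒≈ continue)))
  where
  interact : unify (patb n bs) (patt n ts) ≡ just (outputImages n bs , inputImages n σ)
  interact rewrite unify-out-inp n ts bs | m = refl
  continue : subProc (envOf (inputImages n σ)) (subProc shift1 (⟦ P ⟧ (bvT ts + n)))
             ≡ ⟦ subL (envL σ) P ⟧ n
  continue rewrite sym (match-length ts bs m) = tr-receive n σ P
simulate (par r) n = par (simulate r n)
simulate (res r) n = res (simulate r (suc n))
simulate (struct e r e') n = struct (tr-≈ e n) (simulate r n) (tr-≈ e' n)

≡ᵇ-injective : ∀ {f : Ren} → Injective _≡_ _≡_ f → ∀ x y → (f x ≡ᵇ f y) ≡ (x ≡ᵇ y)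
≡ᵇ-injective {f} inj x y = ≡ᵇ-cong inj (cong f)

liftL-injective : ∀ {f} → Injective _≡_ _≡_ f → ∀ k → Injective _≡_ _≡_ (liftL k f)
liftL-injective inj zero e = inj e
liftL-injective inj (suc k) {zero} {zero} e = refl
liftL-injective inj (suc k) {suc x} {suc y} e = cong suc (liftL-injective inj k (suc-injective e))

swapL-injective : Injective _≡_ _≡_ swapL
swapL-injective {x} {y} e = begin
  x                 ≡⟨ sym (swapL-involutive x) ⟩
  swapL (swapL x)   ≡⟨ cong swapL e ⟩
  swapL (swapL y)   ≡⟨ swapL-involutive y ⟩
  y ∎
  where
  open ≡-Reasoning
  swapL-involutive : ∀ i → swapL (swapL i) ≡ i
  swapL-involutive zero = refl
  swapL-involutive (suc zero) = refl
  swapL-involutive (suc (suc i)) = refl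

-- Recognising translated prefixes.  shape n p tells whether p is patb n bs
-- (an output), patt n ts (an input) or neither; it walks the cells of the
-- pattern, the auxiliary functions looking one and two levels deep.
data Shape : Set where
  output : List ℕ → Shape
  input  : List Field → Shape
  other  : Shape

renShape : Ren → Shape → Shape
renShape f (output bs) = output (mapL f bs)
renShape f (input ts) = input (mapL (subField f) ts)
renShape f other = other

consOut : ℕ → Shape → Shape
consOut b (output bs) = output (b ∷ bs)
consOut b _ = other

consIn : Field → Shape → Shape
consIn t (input ts) = input (t ∷ ts)
consIn t _ = other

marked : ℕ → ℕ → Shape → Shape
marked n m s = if m ≡ᵇ n then s else other

shape : ℕ → Pat → Shape
shape₁ : ℕ → Pat → Pat → Shape
shape₂ : ℕ → Pat → Pat → Pat → Shape
shape n (a • b) = shape₁ n a b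
shape n _ = other
shape₁ n (var m) bnd = marked n m (output [])
shape₁ n bnd (var m) = marked n m (input [])
shape₁ n (c • d) r = shape₂ n c d r
shape₁ n _ _ = other
shape₂ n (var b) bnd r = consOut b (shape n r)
shape₂ n bnd (var m) r = marked n m (consIn bindF (shape n r))
shape₂ n (prot c) (var m) r = marked n m (consIn (protF c) (shape n r))
shape₂ n _ _ _ = other

Sound : ℕ → Pat → Shape → Set
Sound n p (output bs) = p ≡ patb n bs
Sound n p (input ts) = p ≡ patt n ts
Sound n p other = ⊤

marked-sound : ∀ {p} n m s → (m ≡ n → Sound n p s) → Sound n p (marked n m s)
marked-sound n m s k with m ≡ᵇ n in e
... | true = k (≡ᵇ⇒≡ m n (Equivalence.from T-≡ e))
... | false = tt

consOut-sound : ∀ {n r} b s → Sound n r s → Sound n (var b • bnd • r) (consOut b s)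
consOut-sound b (output bs) refl = refl
consOut-sound b (input _) _ = tt
consOut-sound b other _ = tt

consIn-sound : ∀ {n r} t s → Sound n r s → Sound n (fieldPat t • var n • r) (consIn t s)
consIn-sound t (input ts) refl = refl
consIn-sound t (output _) _ = tt
consIn-sound t other _ = tt

shape-sound : ∀ n p → Sound n p (shape n p)
shape₁-sound : ∀ n a b → Sound n (a • b) (shape₁ n a b)
shape₂-sound : ∀ n c d r → Sound n (c • d • r) (shape₂ n c d r)
shape-sound n bnd = tt
shape-sound n (var x) = tt
shape-sound n (prot x) = tt
shape-sound n (a • b) = shape₁-sound n a b
shape₁-sound n (var m) bnd = marked-sound n m (output []) (cong (λ k → var k • bnd))
shape₁-sound n (var m) (var _) = tt
shape₁-sound n (var m) (prot _) = tt
shape₁-sound n (var m) (_ • _) = tt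
shape₁-sound n bnd (var m) = marked-sound n m (input []) (cong (λ k → bnd • var k))
shape₁-sound n bnd bnd = tt
shape₁-sound n bnd (prot _) = tt
shape₁-sound n bnd (_ • _) = tt
shape₁-sound n (prot _) r = tt
shape₁-sound n (c • d) r = shape₂-sound n c d r
shape₂-sound n (var b) bnd r = consOut-sound b (shape n r) (shape-sound n r)
shape₂-sound n (var b) (var _) r = tt
shape₂-sound n (var b) (prot _) r = tt
shape₂-sound n (var b) (_ • _) r = tt
shape₂-sound n bnd (var m) r =
  marked-sound n m (consIn bindF (shape n r)) λ { refl → consIn-sound bindF (shape n r) (shape-sound n r) }
shape₂-sound n bnd bnd r = tt
shape₂-sound n bnd (prot _) r = tt
shape₂-sound n bnd (_ • _) r = tt
shape₂-sound n (prot c) (var m) r =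
  marked-sound n m (consIn (protF c) (shape n r)) λ { refl → consIn-sound (protF c) (shape n r) (shape-sound n r) }
shape₂-sound n (prot c) bnd r = tt
shape₂-sound n (prot c) (prot _) r = tt
shape₂-sound n (prot c) (_ • _) r = tt
shape₂-sound n (_ • _) d r = tt

shape-patb : ∀ n bs → shape n (patb n bs) ≡ output bs
shape-patb n [] rewrite ≡ᵇ-refl n = refl
shape-patb n (b ∷ bs) rewrite shape-patb n bs = refl

shape-patt : ∀ n ts → shape n (patt n ts) ≡ input ts
shape-patt n [] rewrite ≡ᵇ-refl n = refl
shape-patt n (bindF ∷ ts) rewrite ≡ᵇ-refl n | shape-patt n ts = refl
shape-patt n (protF c ∷ ts) rewrite ≡ᵇ-refl n | shape-patt n ts = refl

module _ {f : Ren} (inj : Injective _≡_ _≡_ f) where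

  marked-ren : ∀ n m s → marked (f n) (f m) (renShape f s) ≡ renShape f (marked n m s)
  marked-ren n m s rewrite ≡ᵇ-injective inj m n with m ≡ᵇ n
  ... | true = refl
  ... | false = refl

  consOut-ren : ∀ b s → consOut (f b) (renShape f s) ≡ renShape f (consOut b s)
  consOut-ren b (output bs) = refl
  consOut-ren b (input _) = refl
  consOut-ren b other = refl

  consIn-ren : ∀ t s → consIn (subField f t) (renShape f s) ≡ renShape f (consIn t s)
  consIn-ren t (input ts) = refl
  consIn-ren t (output _) = refl
  consIn-ren t other = refl

  shape-ren : ∀ n p → shape (f n) (renPat f p) ≡ renShape f (shape n p)
  shape₁-ren : ∀ n a b → shape₁ (f n) (renPat f a) (renPat f b) ≡ renShape f (shape₁ n a b)
  shape₂-ren : ∀ n c d r →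
    shape₂ (f n) (renPat f c) (renPat f d) (renPat f r) ≡ renShape f (shape₂ n c d r)
  shape-ren n bnd = refl
  shape-ren n (var x) = refl
  shape-ren n (prot x) = refl
  shape-ren n (a • b) = shape₁-ren n a b
  shape₁-ren n (var m) bnd = marked-ren n m (output [])
  shape₁-ren n (var m) (var _) = refl
  shape₁-ren n (var m) (prot _) = refl
  shape₁-ren n (var m) (_ • _) = refl
  shape₁-ren n bnd (var m) = marked-ren n m (input [])
  shape₁-ren n bnd bnd = refl
  shape₁-ren n bnd (prot _) = refl
  shape₁-ren n bnd (_ • _) = refl
  shape₁-ren n (prot _) r = refl
  shape₁-ren n (c • d) r = shape₂-ren n c d r
  shape₂-ren n (var b) bnd r rewrite shape-ren n r = consOut-ren b (shape n r)
  shape₂-ren n (var b) (var _) r = refl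
  shape₂-ren n (var b) (prot _) r = refl
  shape₂-ren n (var b) (_ • _) r = refl
  shape₂-ren n bnd (var m) r rewrite shape-ren n r =
    trans (cong (marked (f n) (f m)) (consIn-ren bindF (shape n r)))
          (marked-ren n m (consIn bindF (shape n r)))
  shape₂-ren n bnd bnd r = refl
  shape₂-ren n bnd (prot _) r = refl
  shape₂-ren n bnd (_ • _) r = refl
  shape₂-ren n (prot c) (var m) r rewrite shape-ren n r =
    trans (cong (marked (f n) (f m)) (consIn-ren (protF c) (shape n r)))
          (marked-ren n m (consIn (protF c) (shape n r)))
  shape₂-ren n (prot c) bnd r = refl
  shape₂-ren n (prot c) (prot _) r = refl
  shape₂-ren n (prot c) (_ • _) r = refl
  shape₂-ren n (_ • _) d r = refl

freshN : ℕ → ℕ → Bool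
freshN k x = not (x ≡ᵇ k)

freshP : ℕ → Pat → Bool
freshP k bnd = true
freshP k (var x) = freshN k x
freshP k (prot x) = freshN k x
freshP k (p • q) = freshP k p ∧ freshP k q

fresh : ℕ → Proc → Bool
fresh k nil = true
fresh k tick = true
fresh k (P ∥ Q) = fresh k P ∧ fresh k Q
fresh k (rep P) = fresh k P
fresh k (new P) = fresh (suc k) P
fresh k (p ▹ P) = freshP k p ∧ fresh (bv p + k) P

T-∧ˡ : ∀ {a b} → T (a ∧ b) → T a
T-∧ˡ t = proj₁ (Equivalence.to T-∧ t)

T-∧ʳ : ∀ {a b} → T (a ∧ b) → T b
T-∧ʳ t = proj₂ (Equivalence.to T-∧ t)

freshN-≢ : ∀ k x → T (freshN k x) → x ≢ k
freshN-≢ k x t refl = subst (T ∘ not) (≡ᵇ-refl x) t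

≢-freshN : ∀ k x → x ≢ k → T (freshN k x)
≢-freshN k x ne with x ≡ᵇ k in e
... | true = ne (≡ᵇ⇒≡ x k (Equivalence.from T-≡ e))
... | false = tt

liftL-agree : ∀ {f g k} → (∀ i → i ≢ k → f i ≡ g i) → ∀ m i → i ≢ m + k → liftL m f i ≡ liftL m g i
liftL-agree a zero i ne = a i ne
liftL-agree a (suc m) zero ne = refl
liftL-agree a (suc m) (suc i) ne = cong suc (liftL-agree a m i (ne ∘ cong suc))

freshP-agree : ∀ {f g} k p → T (freshP k p) → (∀ i → i ≢ k → f i ≡ g i) → renPat f p ≡ renPat g p
freshP-agree k bnd t a = refl
freshP-agree k (var x) t a = cong var (a x (freshN-≢ k x t))
freshP-agree k (prot x) t a = cong prot (a x (freshN-≢ k x t))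
freshP-agree k (p • q) t a = cong₂ _•_ (freshP-agree k p (T-∧ˡ t) a) (freshP-agree k q (T-∧ʳ t) a)

fresh-agree : ∀ {f g} k X → T (fresh k X) → (∀ i → i ≢ k → f i ≡ g i) → renProc f X ≡ renProc g X
fresh-agree k nil t a = refl
fresh-agree k tick t a = refl
fresh-agree k (P ∥ Q) t a = cong₂ _∥_ (fresh-agree k P (T-∧ˡ t) a) (fresh-agree k Q (T-∧ʳ t) a)
fresh-agree k (rep P) t a = cong rep (fresh-agree k P t a)
fresh-agree k (new P) t a = cong new (fresh-agree (suc k) P t (liftL-agree a 1))
fresh-agree k (p ▹ P) t a =
  cong₂ _▹_ (freshP-agree k p (T-∧ˡ t) a) (fresh-agree (bv p + k) P (T-∧ʳ t) (liftL-agree a (bv p)))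

liftL-avoid : ∀ {f k} → (∀ i → f i ≢ k) → ∀ m i → liftL m f i ≢ m + k
liftL-avoid a zero i = a i
liftL-avoid a (suc m) zero ()
liftL-avoid a (suc m) (suc i) e = liftL-avoid a m i (suc-injective e)

freshP-avoid : ∀ {f} k p → (∀ i → f i ≢ k) → T (freshP k (renPat f p))
freshP-avoid k bnd a = tt
freshP-avoid {f} k (var x) a = ≢-freshN k (f x) (a x)
freshP-avoid {f} k (prot x) a = ≢-freshN k (f x) (a x)
freshP-avoid k (p • q) a = Equivalence.from T-∧ (freshP-avoid k p a , freshP-avoid k q a)

fresh-avoid : ∀ {f} k X → (∀ i → f i ≢ k) → T (fresh k (renProc f X))
fresh-avoid k nil a = tt
fresh-avoid k tick a = tt
fresh-avoid k (P ∥ Q) a = Equivalence.from T-∧ (fresh-avoid k P a , fresh-avoid k Q a)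
fresh-avoid k (rep P) a = fresh-avoid k P a
fresh-avoid k (new P) a = fresh-avoid (suc k) P (liftL-avoid a 1)
fresh-avoid {f} k (p ▹ P) a rewrite bv-ren f p =
  Equivalence.from T-∧ (freshP-avoid k p a , fresh-avoid (bv p + k) P (liftL-avoid a (bv p)))

freshP-ren : ∀ {f} → Injective _≡_ _≡_ f → ∀ k p → freshP (f k) (renPat f p) ≡ freshP k p
freshP-ren inj k bnd = refl
freshP-ren inj k (var x) = cong not (≡ᵇ-injective inj x k)
freshP-ren inj k (prot x) = cong not (≡ᵇ-injective inj x k)
freshP-ren inj k (p • q) = cong₂ _∧_ (freshP-ren inj k p) (freshP-ren inj k q)

fresh-ren : ∀ {f} → Injective _≡_ _≡_ f → ∀ k X → fresh (f k) (renProc f X) ≡ fresh k X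
fresh-ren inj k nil = refl
fresh-ren inj k tick = refl
fresh-ren inj k (P ∥ Q) = cong₂ _∧_ (fresh-ren inj k P) (fresh-ren inj k Q)
fresh-ren inj k (rep P) = fresh-ren inj k P
fresh-ren inj k (new P) = fresh-ren (liftL-injective inj 1) (suc k) P
fresh-ren {f} inj k (p ▹ P) rewrite bv-ren f p =
  cong₂ _∧_ (freshP-ren inj k p)
    (trans (cong (λ z → fresh z (renProc (liftL (bv p) f) P)) (sym (liftL-+ (bv p) f k)))
           (fresh-ren (liftL-injective inj (bv p)) (bv p + k) P))

fresh-≈ : ∀ {X Y} → X ≈ Y → ∀ k → fresh k X ≡ fresh k Y
fresh-≈ ≈-refl k = refl
fresh-≈ (≈-sym e) k = sym (fresh-≈ e k)
fresh-≈ (≈-trans e e') k = trans (fresh-≈ e k) (fresh-≈ e' k)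
fresh-≈ (≈-par e e') k = cong₂ _∧_ (fresh-≈ e k) (fresh-≈ e' k)
fresh-≈ (≈-rep e) k = fresh-≈ e k
fresh-≈ (≈-new e) k = fresh-≈ e (suc k)
fresh-≈ (≈-case {p} e) k = cong (freshP k p ∧_) (fresh-≈ e (bv p + k))
fresh-≈ (par-nil {P}) k = ∧-identityʳ (fresh k P)
fresh-≈ (par-comm {P}) k = ∧-comm (fresh k P) _
fresh-≈ (par-assoc {P}) k = ∧-assoc (fresh k P) _ _
fresh-≈ new-nil k = refl
fresh-≈ (new-swap {P}) k =
  sym (trans (cong (fresh (suc (suc k))) (swap-ren P)) (fresh-ren swapL-injective (suc (suc k)) P))
fresh-≈ (rep-unf {P}) k = sym (∧-idem (fresh k P))
fresh-≈ (extrude {P} {Q}) k =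
  cong (_∧ fresh (suc k) Q) (sym (trans (cong (fresh (suc k)) (shift-ren P)) (fresh-ren suc-injective k P)))

-- Inert processes: built from 0 by parallel composition and restriction;
-- this is what congruence can turn the continuation 0 of an output into.
inert : Proc → Bool
inert nil = true
inert tick = false
inert (P ∥ Q) = inert P ∧ inert Q
inert (rep P) = false
inert (new P) = inert P
inert (p ▹ P) = false

inert-sub : ∀ σ X → inert (subProc σ X) ≡ inert X
inert-sub σ nil = refl
inert-sub σ tick = refl
inert-sub σ (P ∥ Q) = cong₂ _∧_ (inert-sub σ P) (inert-sub σ Q)
inert-sub σ (rep P) = refl
inert-sub σ (new P) = inert-sub (lift1 σ) P
inert-sub σ (p ▹ P) = refl

inert-ren : ∀ f X → inert (renProc f X) ≡ inert X
inert-ren f X = trans (cong inert (sym (subProc-ren (λ i → refl) X))) (inert-sub (var ∘ f) X)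

inert-≈nil : ∀ X → T (inert X) → X ≈ nil
inert-≈nil nil t = ≈-refl
inert-≈nil (P ∥ Q) t = ≈-trans (≈-par (inert-≈nil P (T-∧ˡ t)) (inert-≈nil Q (T-∧ʳ t))) par-nil
inert-≈nil (new P) t = ≈-trans (≈-new (inert-≈nil P t)) new-nil

inert-≈ : ∀ {X Y} → X ≈ Y → inert X ≡ inert Y
inert-≈ ≈-refl = refl
inert-≈ (≈-sym e) = sym (inert-≈ e)
inert-≈ (≈-trans e e') = trans (inert-≈ e) (inert-≈ e')
inert-≈ (≈-par e e') = cong₂ _∧_ (inert-≈ e) (inert-≈ e')
inert-≈ (≈-rep e) = refl
inert-≈ (≈-new e) = inert-≈ e
inert-≈ (≈-case e) = refl
inert-≈ (par-nil {P}) = ∧-identityʳ (inert P)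
inert-≈ (par-comm {P}) = ∧-comm (inert P) _
inert-≈ (par-assoc {P}) = ∧-assoc (inert P) _ _
inert-≈ new-nil = refl
inert-≈ (new-swap {P}) = sym (inert-sub swap01 P)
inert-≈ (rep-unf {P}) = sym (∧-zeroʳ (inert P))
inert-≈ (extrude {P} {Q}) = cong (_∧ inert Q) (sym (inert-sub shift1 P))

-- Decoding.  decodable n X checks that X is a translation with marker n up to
-- what structural congruence can change inside prefixes: the continuation of
-- an output is inert, the body of an input does not use the trailing marker
-- binder and is itself decodable.  decode n X reads off the Linda process.
caseShape : {A : Set} → Shape → (List ℕ → A) → (List Field → A) → A → A
caseShape (output bs) o i x = o bs
caseShape (input ts) o i x = i ts
caseShape other o i x = x

dropBinder : ℕ → Ren
dropBinder m zero = m
dropBinder m (suc j) = j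

decodable : ℕ → Proc → Bool
decodable n nil = true
decodable n tick = true
decodable n (P ∥ Q) = decodable n P ∧ decodable n Q
decodable n (rep P) = decodable n P
decodable n (new P) = decodable (suc n) P
decodable n (p ▹ B) =
  caseShape (shape n p) (λ _ → inert B) (λ _ → fresh 0 B ∧ decodable (bv p + n) B) false

decode : ℕ → Proc → LProc
decode n nil = lnil
decode n tick = ltick
decode n (P ∥ Q) = decode n P ∥L decode n Q
decode n (rep P) = lrep (decode n P)
decode n (new P) = lnew (decode (suc n) P)
decode n (p ▹ B) =
  caseShape (shape n p) out (λ ts → inp ts (subL (dropBinder (bvT ts + n)) (decode (bv p + n) B))) lnil

decode-output : ∀ n bs B → decode n (patb n bs ▹ B) ≡ out bs
decode-output n bs B rewrite shape-patb n bs = refl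

decode-input : ∀ n ts B →
  decode n (patt n ts ▹ B) ≡ inp ts (subL (dropBinder (bvT ts + n)) (decode (suc (bvT ts) + n) B))
decode-input n ts B rewrite shape-patt n ts | bv-patt n ts = refl

data Prefix (n : ℕ) : Pat → Proc → Set where
  outputPrefix : ∀ bs {B} → T (inert B) → Prefix n (patb n bs) B
  inputPrefix  : ∀ ts {B} → T (fresh 0 B) → T (decodable (suc (bvT ts) + n) B) → Prefix n (patt n ts) B

prefix : ∀ n p B → T (decodable n (p ▹ B)) → Prefix n p B
prefix n p B t with shape n p | shape-sound n p
... | output bs | refl = outputPrefix bs t
... | input ts | refl rewrite bv-patt n ts = inputPrefix ts (T-∧ˡ t) (T-∧ʳ t)
... | other | _ = ⊥-elim t

dropBinder-natural : ∀ f b n →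
  dropBinder (b + f n) ∘ liftL (suc b) f ≗ liftL b f ∘ dropBinder (b + n)
dropBinder-natural f b n zero = sym (liftL-+ b f n)
dropBinder-natural f b n (suc i) = refl

decodable-ren : ∀ {f} → Injective _≡_ _≡_ f → ∀ n X → decodable (f n) (renProc f X) ≡ decodable n X
decodable-ren inj n nil = refl
decodable-ren inj n tick = refl
decodable-ren inj n (P ∥ Q) = cong₂ _∧_ (decodable-ren inj n P) (decodable-ren inj n Q)
decodable-ren inj n (rep P) = decodable-ren inj n P
decodable-ren inj n (new P) = decodable-ren (liftL-injective inj 1) (suc n) P
decodable-ren {f} inj n (p ▹ B) rewrite shape-ren inj n p | bv-ren f p
  with shape n p | shape-sound n p
... | output _ | _ = inert-ren _ B
... | other | _ = refl
... | input ts | refl rewrite bv-patt n ts =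
  cong₂ _∧_ (fresh-ren inj' 0 B)
    (trans (cong (λ z → decodable z (renProc (liftL (suc (bvT ts)) f) B)) (sym (liftL-+ (suc (bvT ts)) f n)))
           (decodable-ren inj' (suc (bvT ts) + n) B))
  where inj' = liftL-injective inj (suc (bvT ts))

decode-ren : ∀ {f} → Injective _≡_ _≡_ f → ∀ n X → decode (f n) (renProc f X) ≡ subL f (decode n X)
decode-ren inj n nil = refl
decode-ren inj n tick = refl
decode-ren inj n (P ∥ Q) = cong₂ _∥L_ (decode-ren inj n P) (decode-ren inj n Q)
decode-ren inj n (rep P) = cong lrep (decode-ren inj n P)
decode-ren inj n (new P) = cong lnew (decode-ren (liftL-injective inj 1) (suc n) P)
decode-ren {f} inj n (p ▹ B) rewrite shape-ren inj n p | bv-ren f p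
  with shape n p | shape-sound n p
... | output _ | _ = refl
... | other | _ = refl
... | input ts | refl rewrite bv-patt n ts | bvT-sub f ts = cong (inp _) body
  where
  b = bvT ts
  g = liftL (suc b) f
  body : subL (dropBinder (b + f n)) (decode (suc b + f n) (renProc g B))
       ≡ subL (liftL b f) (subL (dropBinder (b + n)) (decode (suc b + n) B))
  body = begin
    subL (dropBinder (b + f n)) (decode (suc b + f n) (renProc g B))
      ≡⟨ cong (λ z → subL (dropBinder (b + f n)) (decode z (renProc g B))) (sym (liftL-+ (suc b) f n)) ⟩
    subL (dropBinder (b + f n)) (decode (g (suc b + n)) (renProc g B))
      ≡⟨ cong (subL _) (decode-ren (liftL-injective inj (suc b)) (suc b + n) B) ⟩
    subL (dropBinder (b + f n)) (subL g (decode (suc b + n) B))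
      ≡⟨ subL-square (dropBinder-natural f b n) _ ⟩
    subL (liftL b f) (subL (dropBinder (b + n)) (decode (suc b + n) B)) ∎
    where open ≡-Reasoning

decodable-≈ : ∀ {X Y} → X ≈ Y → ∀ n → decodable n X ≡ decodable n Y
decodable-≈ ≈-refl n = refl
decodable-≈ (≈-sym e) n = sym (decodable-≈ e n)
decodable-≈ (≈-trans e e') n = trans (decodable-≈ e n) (decodable-≈ e' n)
decodable-≈ (≈-par e e') n = cong₂ _∧_ (decodable-≈ e n) (decodable-≈ e' n)
decodable-≈ (≈-rep e) n = decodable-≈ e n
decodable-≈ (≈-new e) n = decodable-≈ e (suc n)
decodable-≈ (≈-case {p} e) n rewrite inert-≈ e | fresh-≈ e 0 | decodable-≈ e (bv p + n) = refl
decodable-≈ (par-nil {P}) n = ∧-identityʳ (decodable n P)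
decodable-≈ (par-comm {P}) n = ∧-comm (decodable n P) _
decodable-≈ (par-assoc {P}) n = ∧-assoc (decodable n P) _ _
decodable-≈ new-nil n = refl
decodable-≈ (new-swap {P}) n =
  sym (trans (cong (decodable (suc (suc n))) (swap-ren P)) (decodable-ren swapL-injective (suc (suc n)) P))
decodable-≈ (rep-unf {P}) n = sym (∧-idem (decodable n P))
decodable-≈ (extrude {P} {Q}) n =
  cong (_∧ decodable (suc n) Q)
    (sym (trans (cong (decodable (suc n)) (shift-ren P)) (decodable-ren suc-injective n P)))

decode-≈ : ∀ {X Y} → X ≈ Y → ∀ n → decode n X ≈L decode n Y
decode-≈ ≈-refl n = ≈-refl
decode-≈ (≈-sym e) n = ≈-sym (decode-≈ e n)
decode-≈ (≈-trans e e') n = ≈-trans (decode-≈ e n) (decode-≈ e' n)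
decode-≈ (≈-par e e') n = ≈-par (decode-≈ e n) (decode-≈ e' n)
decode-≈ (≈-rep e) n = ≈-rep (decode-≈ e n)
decode-≈ (≈-new e) n = ≈-new (decode-≈ e (suc n))
decode-≈ (≈-case {p} e) n with shape n p
... | output _ = ≈-refl
... | input ts = ≈-inp (subL-≈L _ (decode-≈ e (bv p + n)))
... | other = ≈-refl
decode-≈ par-nil n = par-nil
decode-≈ par-comm n = par-comm
decode-≈ par-assoc n = par-assoc
decode-≈ new-nil n = new-nil
decode-≈ (new-swap {P}) n =
  ≈-trans new-swap (≈-new (≈-new (≡⇒≈L (sym
    (trans (cong (decode (suc (suc n))) (swap-ren P)) (decode-ren swapL-injective (suc (suc n)) P))))))
decode-≈ rep-unf n = rep-unf
decode-≈ (extrude {P}) n =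
  ≈-trans extrude (≈-new (≈-par (≡⇒≈L (sym
    (trans (cong (decode (suc n)) (shift-ren P)) (decode-ren suc-injective n P)))) ≈-refl))

decode-tr : ∀ L n → decode n (⟦ L ⟧ n) ≡ L
decode-tr lnil n = refl
decode-tr ltick n = refl
decode-tr (out bs) n = decode-output n bs nil
decode-tr (inp ts P) n rewrite decode-input n ts (subProc shift1 (⟦ P ⟧ (bvT ts + n))) = cong (inp ts) (begin
  subL (dropBinder (b + n)) (decode (suc (b + n)) (subProc shift1 (⟦ P ⟧ (b + n))))
    ≡⟨ cong (subL (dropBinder (b + n)) ∘ decode (suc (b + n))) (shift-ren (⟦ P ⟧ (b + n))) ⟩
  subL (dropBinder (b + n)) (decode (suc (b + n)) (renProc suc (⟦ P ⟧ (b + n))))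
    ≡⟨ cong (subL (dropBinder (b + n))) (decode-ren suc-injective (b + n) (⟦ P ⟧ (b + n))) ⟩
  subL (dropBinder (b + n)) (subL suc (decode (b + n) (⟦ P ⟧ (b + n))))
    ≡⟨ cong (subL (dropBinder (b + n)) ∘ subL suc) (decode-tr P (b + n)) ⟩
  subL (dropBinder (b + n)) (subL suc P)
    ≡⟨ subL-∘ (dropBinder (b + n)) suc P ⟩
  subL id P
    ≡⟨ subL-id P ⟩
  P ∎)
  where
  b = bvT ts
  open ≡-Reasoning
decode-tr (lnew P) n = cong lnew (decode-tr P (suc n))
decode-tr (P ∥L Q) n = cong₂ _∥L_ (decode-tr P n) (decode-tr Q n)
decode-tr (lrep P) n = cong lrep (decode-tr P n)

decodable-tr : ∀ L n → T (decodable n (⟦ L ⟧ n))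
decodable-tr lnil n = tt
decodable-tr ltick n = tt
decodable-tr (out bs) n rewrite shape-patb n bs = tt
decodable-tr (inp ts P) n
  rewrite shape-patt n ts | bv-patt n ts | shift-ren (⟦ P ⟧ (bvT ts + n))
        | decodable-ren suc-injective (bvT ts + n) (⟦ P ⟧ (bvT ts + n)) =
  Equivalence.from T-∧ (fresh-avoid 0 (⟦ P ⟧ (bvT ts + n)) (λ i ()) , decodable-tr P (bvT ts + n))
decodable-tr (lnew P) n = decodable-tr P (suc n)
decodable-tr (P ∥L Q) n = Equivalence.from T-∧ (decodable-tr P n , decodable-tr Q n)
decodable-tr (lrep P) n = decodable-tr P n

body-≈ : ∀ m B L → T (fresh 0 B) → B ≈ ⟦ L ⟧ (suc m) → B ≈ subProc shift1 (⟦ subL (dropBinder m) L ⟧ m)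
body-≈ m B L fr e = ≈-trans (≡⇒≈ unused) (≈-trans (ren-≈ (suc ∘ dropBinder m) e) (≡⇒≈ lowered))
  where
  agree : ∀ i → i ≢ 0 → id i ≡ suc (dropBinder m i)
  agree zero ne = ⊥-elim (ne refl)
  agree (suc i) ne = refl
  unused : B ≡ renProc (suc ∘ dropBinder m) B
  unused = trans (sym (renProc-id B)) (fresh-agree 0 B fr agree)
  lowered : renProc (suc ∘ dropBinder m) (⟦ L ⟧ (suc m)) ≡ subProc shift1 (⟦ subL (dropBinder m) L ⟧ m)
  lowered = begin
    renProc (suc ∘ dropBinder m) (⟦ L ⟧ (suc m))     ≡⟨ sym (renProc-∘ suc (dropBinder m) _) ⟩
    renProc suc (renProc (dropBinder m) (⟦ L ⟧ (suc m))) ≡⟨ cong (renProc suc) (ren-tr (dropBinder m) L (suc m)) ⟩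
    renProc suc (⟦ subL (dropBinder m) L ⟧ m)       ≡⟨ sym (shift-ren _) ⟩
    subProc shift1 (⟦ subL (dropBinder m) L ⟧ m)    ∎
    where open ≡-Reasoning

tr-decode : ∀ n X → T (decodable n X) → X ≈ ⟦ decode n X ⟧ n
tr-decode n nil t = ≈-refl
tr-decode n tick t = ≈-refl
tr-decode n (P ∥ Q) t = ≈-par (tr-decode n P (T-∧ˡ t)) (tr-decode n Q (T-∧ʳ t))
tr-decode n (rep P) t = ≈-rep (tr-decode n P t)
tr-decode n (new P) t = ≈-new (tr-decode (suc n) P t)
tr-decode n (p ▹ B) t with prefix n p B t
... | outputPrefix bs inrt rewrite decode-output n bs B = ≈-case (inert-≈nil B inrt)
... | inputPrefix ts fr dec rewrite decode-input n ts B =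
  ≈-case (body-≈ (bvT ts + n) B _ fr (tr-decode (suc (bvT ts) + n) B dec))

receive-≈ : ∀ n σ B L → T (fresh 0 B) → B ≈ ⟦ L ⟧ (suc (length σ + n)) →
  subProc (envOf (inputImages n σ)) B ≈ ⟦ subL (envL σ) (subL (dropBinder (length σ + n)) L) ⟧ n
receive-≈ n σ B L fr e =
  ≈-trans (≡⇒≈ (subProc-ren (envOf-inputImages n σ) B))
    (≈-trans (ren-≈ (inputRen n σ) (body-≈ (length σ + n) B L fr e))
      (≡⇒≈ (trans (sym (subProc-ren (envOf-inputImages n σ) _)) (tr-receive n σ _))))

reflect-comm : ∀ n bs ts {P Q σ ρ} → unify (patb n bs) (patt n ts) ≡ just (σ , ρ) →
  T (inert P) → T (fresh 0 Q) → T (decodable (suc (bvT ts) + n) Q) →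
  Σ LProc (λ L → (decode n (patb n bs ▹ P) ∥L decode n (patt n ts ▹ Q) ⟶L L)
               × (subProc (envOf σ) P ∥ subProc (envOf ρ) Q ≈ ⟦ L ⟧ n))
reflect-comm n bs ts {P} {Q} u inrt fr dec
  rewrite decode-output n bs P | decode-input n ts Q | unify-out-inp n ts bs
  with match ts bs in m | u
... | just σ | refl rewrite sym (match-length ts bs m) =
  _ , struct ≈-refl (comm m) ≈-refl ,
  ≈-trans (≈-par (inert-≈nil _ (subst T (sym (inert-sub _ P)) inrt)) ≈-refl)
    (≈-trans par-comm (≈-trans par-nil (receive-≈ n σ Q _ fr (tr-decode _ Q dec))))

reflect : ∀ n {X Y} → T (decodable n X) → X ⟶ Y →
  Σ LProc (λ L → (decode n X ⟶L L) × (Y ≈ ⟦ L ⟧ n))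
reflect n {(p ▹ P) ∥ (q ▹ Q)} t (comm u) with prefix n p P (T-∧ˡ t) | prefix n q Q (T-∧ʳ t)
... | outputPrefix bs _ | outputPrefix bs' _ with () ← trans (sym u) (unify-out-out n bs bs')
... | inputPrefix ts _ _ | inputPrefix ts' _ _ with () ← trans (sym u) (unify-inp-inp n ts ts')
... | outputPrefix bs inrt | inputPrefix ts fr dec = reflect-comm n bs ts u inrt fr dec
... | inputPrefix ts fr dec | outputPrefix bs inrt
  with reflect-comm n bs ts (trans (unify-sym (patt n ts) (patb n bs)) (cong (mapMaybe swap) u)) inrt fr dec
... | L , red , e = L , struct par-comm red ≈-refl , ≈-trans par-comm e
reflect n {P ∥ R} t (par r) with reflect n (T-∧ˡ t) r
... | L , red , e = (L ∥L decode n R) , par red , ≈-par e (tr-decode n R (T-∧ʳ t))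
reflect n {new P} t (res r) with reflect (suc n) t r
... | L , red , e = lnew L , res red , ≈-new e
reflect n t (struct e r e') with reflect n (subst T (decodable-≈ e n) t) r
... | L , red , e'' = L , struct (decode-≈ e n) red ≈-refl , ≈-trans (≈-sym e') e''

theorem4p8 : (𝗇 : ℕ) →
    ((∀ {P P'} → P ⟶L P' → ⟦ P ⟧ 𝗇 ⟶ ⟦ P' ⟧ 𝗇) ×
     (∀ {P Q} → ⟦ P ⟧ 𝗇 ⟶ Q → Σ LProc (λ P' → (P ⟶L P') × (Q ≈ ⟦ P' ⟧ 𝗇))))
theorem4p8 𝗇 = (λ r → simulate r 𝗇) , complete
  where
  complete : ∀ {P Q} → ⟦ P ⟧ 𝗇 ⟶ Q → Σ LProc (λ P' → (P ⟶L P') × (Q ≈ ⟦ P' ⟧ 𝗇))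
  complete {P} r with reflect 𝗇 (decodable-tr P 𝗇) r
  ... | P' , red , e = P' , subst (_⟶L P') (decode-tr P 𝗇) red , e
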